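{- Let $G$ be a graph and $k$ a positive integer. Then $\mathsf{TS}_k(\overline{G})$ is (isomorphic to) a subgraph of $L_k(G)$, via the bijection sending an independent set $\{a_1,\dots,a_k\}$ of $\overline{G}$ to the clique $\{a_1,\dots,a_k\}$ of $G$. Moreover, $L_k(G) \simeq \mathsf{TS}_k(\overline{G})$ if and only if $G$ is $K_{k+1}$-free.
   Context: All graphs are finite, simple and undirected. $\overline{G}$ denotes the complement of $G$. An independent set of a graph is a set of pairwise non-adjacent vertices. For a positive integer $k$, $\mathsf{TS}_k(G)$ is the graph whose vertices are the independent sets of $G$ of size exactly $k$, where two such sets $I,J$ are adjacent iff there exist $u,v\in V(G)$ with $I\setminus J=\{u\}$, $J\setminus I=\{v\}$ and $uv\in E(G)$. $L_k(G)$ is the graph whose vertices are the cliques of $G$ of size exactly $k$, two of them adjacent iff they have exactly $k-1$ vertices in common. A graph is $K_{k+1}$-free if it has no induced subgraph isomorphic to the complete graph $K_{k+1}$. -}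

module Defs where

open import Data.Nat using (ℕ; _∸_; suc)
open import Data.Fin using (Fin)
open import Data.Fin.Subset using (Subset; _∈_; _∩_; _─_; ⁅_⁆; ∣_∣)
open import Data.Product using (Σ; ∃; ∃-syntax; _×_; _,_)
open import Data.Sum using (_⊎_)
open import Relation.Nullary using (¬_; Dec; yes; no)
open import Relation.Binary.PropositionalEquality using (_≡_; _≢_)
open import Function.Bundles using (_⇔_)

-- A finite simple graph on the vertex set Fin n (loopless, symmetric,
-- with decidable adjacency, as every finite graph has classically).
record SimpleGraph (n : ℕ) : Set₁ where
  field
    Adj   : Fin n → Fin n → Set
    sym   : ∀ {u v} → Adj u v → Adj v u
    irrefl : ∀ {u} → ¬ Adj u u
    dec   : ∀ u v → Dec (Adj u v)
open SimpleGraph public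

complement : ∀ {n} → SimpleGraph n → SimpleGraph n
complement {n} G = record
  { Adj    = λ u v → u ≢ v × ¬ Adj G u v
  ; sym    = λ { (u≢v , ¬e) → (λ eq → u≢v (Eq.sym eq)) , (λ e → ¬e (SimpleGraph.sym G e)) }
  ; irrefl = λ { (u≢u , _) → u≢u Eq.refl }
  ; dec    = d
  }
  where
  import Relation.Binary.PropositionalEquality as Eq
  open import Data.Fin using (_≟_)
  d : ∀ u v → Dec (u ≢ v × ¬ Adj G u v)
  d u v with u ≟ v
  ... | yes eq = no (λ { (ne , _) → ne eq })
  ... | no ne with dec G u v
  ...   | yes e = no (λ { (_ , ¬e) → ¬e e })
  ...   | no ¬e = yes (ne , ¬e)

IsIndependent : ∀ {n} → SimpleGraph n → Subset n → Set
IsIndependent G S = ∀ u v → u ∈ S → v ∈ S → ¬ Adj G u v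

IsClique : ∀ {n} → SimpleGraph n → Subset n → Set
IsClique G S = ∀ u v → u ∈ S → v ∈ S → u ≢ v → Adj G u v

record Graph : Set₁ where
  field
    V   : Set
    E   : V → V → Set

-- Vertices of TS_k(G): independent sets of size exactly k.
-- The proof components are irrelevant, so a vertex is determined by its set.
record IndSet {n} (G : SimpleGraph n) (k : ℕ) : Set where
  constructor indSet
  field
    set   : Subset n
    .indep : IsIndependent G set
    .size  : ∣ set ∣ ≡ k
open IndSet public

record KClique {n} (G : SimpleGraph n) (k : ℕ) : Set where
  constructor kClique
  field
    set   : Subset n
    .clique : IsClique G set
    .size   : ∣ set ∣ ≡ k
open KClique public

TS : ∀ {n} → ℕ → SimpleGraph n → Graph
TS {n} k G = record
  { V = IndSet G k
  ; E = λ I J → Σ (Fin n) λ u → Σ (Fin n) λ v →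
          (IndSet.set I ─ IndSet.set J ≡ ⁅ u ⁆) ×
          (IndSet.set J ─ IndSet.set I ≡ ⁅ v ⁆) × Adj G u v
  }

L : ∀ {n} → ℕ → SimpleGraph n → Graph
L {n} k G = record
  { V = KClique G k
  ; E = λ I J → ∣ KClique.set I ∩ KClique.set J ∣ ≡ k ∸ 1
  }

record _≅_ (G H : Graph) : Set where
  field
    to      : Graph.V G → Graph.V H
    from    : Graph.V H → Graph.V G
    from∘to : ∀ x → from (to x) ≡ x
    to∘from : ∀ y → to (from y) ≡ y
    adj     : ∀ x y → Graph.E G x y ⇔ Graph.E H (to x) (to y)

KFree : ∀ {n} → ℕ → SimpleGraph n → Set
KFree k G = ¬ (Σ (Subset _) λ S → IsClique G S × ∣ S ∣ ≡ suc k)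

module Submission where

-- An independent set of the complement of G is literally a clique of G, and a token slide from I
-- to J along an edge uv of the complement (I ∖ J = {u}, J ∖ I = {v}) leaves k − 1 shared vertices.
-- Conversely, k-cliques C, D sharing k − 1 vertices differ by a single token u ↦ v, and this is a
-- slide in the complement unless uv ∈ E(G), in which case C ∪ D is a (k+1)-clique; so the identity
-- is an isomorphism when G is K_{k+1}-free. If S is a (k+1)-clique, then S − a and S − b are
-- adjacent in L_k but not in TS_k, and no isomorphism whatsoever can exist: composed with the
-- identity inclusion TS_k ⊆ L_k it gives an injective self-map of a finite vertex set sending
-- L_k-edges to TS_k-edges, and some iterate of it fixes both S − a and S − b.

open import Defs hiding (sym)
open import Data.Nat using (ℕ; zero; suc; _+_; _*_; _∸_; _^_; _≤_; _<_; s≤s; _≟_)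
open import Data.Nat.GeneralisedArithmetic using (fold; fold-+)
open import Data.Nat.Properties
  using (+-comm; +-suc; +-cancelˡ-≡; *-comm; m+n∸n≡m; n<1+n; n≮0; 0≢1+n; suc-injective; m≤n⇒∃[o]m+o≡n)
open import Data.Fin using (Fin; zero; suc; toℕ; combine)
open import Data.Fin.Properties using (pigeonhole; combine-injective; 2↔Bool)
open import Data.Vec using (_∷_; []; here; there)
open import Data.Fin.Subset
  using (Subset; inside; outside; _∈_; _∉_; _⊆_; _∩_; _∪_; _─_; _-_; ⁅_⁆; ∣_∣; ⊥; Nonempty)
open import Data.Fin.Subset.Properties
  using (x∈⁅x⁆; x∈⁅y⁆⇒x≡y; ∣⁅x⁆∣≡1; ∣⊥∣≡0; ∩-comm; Empty-unique; nonempty?; p─⊥≡p; p─q⊆p;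
         x∈p∪q⁻; x∈p∧x∉q⇒x∈p─q; x∈p⇒∣p-x∣<∣p∣; _∈?_)
open import Data.Product using (Σ; ∃; ∃₂; _×_; _,_)
open import Data.Sum using (_⊎_; inj₁; inj₂)
open import Data.Empty using (⊥-elim)
open import Function using (_∘_)
open import Function.Bundles using (_⇔_; mk⇔; Equivalence; _↣_; mk↣; Injection)
open import Function.Definitions using (Injective)
open import Function.Properties.Inverse using (↔⇒↣; ↔-sym)
open import Relation.Binary.Core using (Rel; _⇒_)
open import Relation.Binary.PropositionalEquality
  using (_≡_; _≢_; refl; sym; trans; cong; cong₂; subst; subst₂; module ≡-Reasoning)
open import Relation.Nullary using (¬_; yes; no; contradiction)
open import Relation.Nullary.Decidable using (recompute)

∣p∣≡∣p∩q∣+∣p─q∣ : ∀ {n} (p q : Subset n) → ∣ p ∣ ≡ ∣ p ∩ q ∣ + ∣ p ─ q ∣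
∣p∣≡∣p∩q∣+∣p─q∣ [] [] = refl
∣p∣≡∣p∩q∣+∣p─q∣ (inside ∷ p) (inside ∷ q) = cong suc (∣p∣≡∣p∩q∣+∣p─q∣ p q)
∣p∣≡∣p∩q∣+∣p─q∣ (inside ∷ p) (outside ∷ q) =
  trans (cong suc (∣p∣≡∣p∩q∣+∣p─q∣ p q)) (sym (+-suc _ _))
∣p∣≡∣p∩q∣+∣p─q∣ (outside ∷ p) (inside ∷ q) = ∣p∣≡∣p∩q∣+∣p─q∣ p q
∣p∣≡∣p∩q∣+∣p─q∣ (outside ∷ p) (outside ∷ q) = ∣p∣≡∣p∩q∣+∣p─q∣ p q

∣p∪q∣≡∣p∣+∣q─p∣ : ∀ {n} (p q : Subset n) → ∣ p ∪ q ∣ ≡ ∣ p ∣ + ∣ q ─ p ∣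
∣p∪q∣≡∣p∣+∣q─p∣ [] [] = refl
∣p∪q∣≡∣p∣+∣q─p∣ (inside ∷ p) (_ ∷ q) = cong suc (∣p∪q∣≡∣p∣+∣q─p∣ p q)
∣p∪q∣≡∣p∣+∣q─p∣ (outside ∷ p) (inside ∷ q) =
  trans (cong suc (∣p∪q∣≡∣p∣+∣q─p∣ p q)) (sym (+-suc _ _))
∣p∪q∣≡∣p∣+∣q─p∣ (outside ∷ p) (outside ∷ q) = ∣p∪q∣≡∣p∣+∣q─p∣ p q

p─q∩p─r≡p─q─r : ∀ {n} (p q r : Subset n) → (p ─ q) ∩ (p ─ r) ≡ p ─ q ─ r
p─q∩p─r≡p─q─r [] [] [] = refl
p─q∩p─r≡p─q─r (_ ∷ p) (inside ∷ q) (inside ∷ r) = cong (outside ∷_) (p─q∩p─r≡p─q─r p q r)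
p─q∩p─r≡p─q─r (_ ∷ p) (inside ∷ q) (outside ∷ r) = cong (outside ∷_) (p─q∩p─r≡p─q─r p q r)
p─q∩p─r≡p─q─r (inside ∷ p) (outside ∷ q) (inside ∷ r) = cong (outside ∷_) (p─q∩p─r≡p─q─r p q r)
p─q∩p─r≡p─q─r (inside ∷ p) (outside ∷ q) (outside ∷ r) = cong (inside ∷_) (p─q∩p─r≡p─q─r p q r)
p─q∩p─r≡p─q─r (outside ∷ p) (outside ∷ q) (inside ∷ r) = cong (outside ∷_) (p─q∩p─r≡p─q─r p q r)
p─q∩p─r≡p─q─r (outside ∷ p) (outside ∷ q) (outside ∷ r) = cong (outside ∷_) (p─q∩p─r≡p─q─r p q r)

x∈p─q⇒x∉q : ∀ {n} {x : Fin n} (p q : Subset n) → x ∈ p ─ q → x ∉ q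
x∈p─q⇒x∉q (_ ∷ p) (inside ∷ q) () here
x∈p─q⇒x∉q (_ ∷ p) (_ ∷ q) (there x∈p─q) (there x∈q) = x∈p─q⇒x∉q p q x∈p─q x∈q

∣p∣≡0⇒p≡⊥ : ∀ {n} {p : Subset n} → ∣ p ∣ ≡ 0 → p ≡ ⊥
∣p∣≡0⇒p≡⊥ {p = p} ∣p∣≡0 = Empty-unique λ (x , x∈p) → n≮0 (subst (∣ p - x ∣ <_) ∣p∣≡0 (x∈p⇒∣p-x∣<∣p∣ x∈p))

∣p∣≡1+m⇒Nonempty : ∀ {n m} (p : Subset n) → ∣ p ∣ ≡ suc m → Nonempty p
∣p∣≡1+m⇒Nonempty {n} {m} p ∣p∣≡1+m with nonempty? p
... | yes nonempty = nonempty
... | no empty = contradiction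
  (trans (sym (trans (cong ∣_∣ (Empty-unique empty)) (∣⊥∣≡0 n))) ∣p∣≡1+m) (0≢1+n {m})

∣p∣≡1⇒p≡⁅x⁆ : ∀ {n} (p : Subset n) → ∣ p ∣ ≡ 1 → ∃ λ x → p ≡ ⁅ x ⁆
∣p∣≡1⇒p≡⁅x⁆ (inside ∷ p) ∣p∣≡1 = zero , cong (inside ∷_) (∣p∣≡0⇒p≡⊥ (suc-injective ∣p∣≡1))
∣p∣≡1⇒p≡⁅x⁆ (outside ∷ p) ∣p∣≡1 with ∣p∣≡1⇒p≡⁅x⁆ p ∣p∣≡1
... | x , p≡⁅x⁆ = suc x , cong (outside ∷_) p≡⁅x⁆

x∈p⇒∣p∣≡1+∣p-x∣ : ∀ {n} {x : Fin n} {p : Subset n} → x ∈ p → ∣ p ∣ ≡ suc ∣ p - x ∣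
x∈p⇒∣p∣≡1+∣p-x∣ {p = _ ∷ p} here = cong (suc ∘ ∣_∣) (sym (p─⊥≡p p))
x∈p⇒∣p∣≡1+∣p-x∣ {p = inside ∷ p} (there x∈p) = cong suc (x∈p⇒∣p∣≡1+∣p-x∣ x∈p)
x∈p⇒∣p∣≡1+∣p-x∣ {p = outside ∷ p} (there x∈p) = x∈p⇒∣p∣≡1+∣p-x∣ x∈p

x∈p⇒∣p-x∣≡m : ∀ {n m} {x : Fin n} {p : Subset n} → x ∈ p → ∣ p ∣ ≡ suc m → ∣ p - x ∣ ≡ m
x∈p⇒∣p-x∣≡m x∈p ∣p∣≡1+m = suc-injective (trans (sym (x∈p⇒∣p∣≡1+∣p-x∣ x∈p)) ∣p∣≡1+m)

∣p─q∣≡1⇒∣p∩q∣≡∣p∣∸1 : ∀ {n} (p q : Subset n) → ∣ p ─ q ∣ ≡ 1 → ∣ p ∩ q ∣ ≡ ∣ p ∣ ∸ 1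
∣p─q∣≡1⇒∣p∩q∣≡∣p∣∸1 p q ∣p─q∣≡1 = begin
  ∣ p ∩ q ∣                 ≡⟨ m+n∸n≡m _ 1 ⟨
  ∣ p ∩ q ∣ + 1 ∸ 1         ≡⟨ cong (λ m → ∣ p ∩ q ∣ + m ∸ 1) ∣p─q∣≡1 ⟨
  ∣ p ∩ q ∣ + ∣ p ─ q ∣ ∸ 1 ≡⟨ cong (_∸ 1) (∣p∣≡∣p∩q∣+∣p─q∣ p q) ⟨
  ∣ p ∣ ∸ 1                 ∎
  where open ≡-Reasoning

∣p∩q∣≡m⇒∣p─q∣≡1 : ∀ {n m} (p q : Subset n) → ∣ p ∣ ≡ suc m → ∣ p ∩ q ∣ ≡ m → ∣ p ─ q ∣ ≡ 1
∣p∩q∣≡m⇒∣p─q∣≡1 {m = m} p q ∣p∣≡1+m ∣p∩q∣≡m = +-cancelˡ-≡ m _ _ (begin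
  m + ∣ p ─ q ∣         ≡⟨ cong (_+ ∣ p ─ q ∣) ∣p∩q∣≡m ⟨
  ∣ p ∩ q ∣ + ∣ p ─ q ∣ ≡⟨ ∣p∣≡∣p∩q∣+∣p─q∣ p q ⟨
  ∣ p ∣                 ≡⟨ ∣p∣≡1+m ⟩
  suc m                 ≡⟨ +-comm 1 m ⟩
  m + 1                 ∎)
  where open ≡-Reasoning

Subset↣Fin[2^n] : ∀ {n} → Subset n ↣ Fin (2 ^ n)
Subset↣Fin[2^n] = mk↣ encode-injective
  where
  open Injection (↔⇒↣ (↔-sym 2↔Bool)) using () renaming (to to bit; injective to bit-injective)

  encode : ∀ {n} → Subset n → Fin (2 ^ n)
  encode [] = zero
  encode (s ∷ p) = combine (bit s) (encode p)

  encode-injective : ∀ {n} → Injective _≡_ _≡_ (encode {n})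
  encode-injective {x = []} {[]} _ = refl
  encode-injective {x = s ∷ p} {t ∷ q} e with combine-injective (bit s) (encode p) (bit t) (encode q) e
  ... | bits≡ , codes≡ = cong₂ _∷_ (bit-injective bits≡) (encode-injective codes≡)

module _ {A : Set} (h : A → A) where

  fold-period-* : ∀ {x P} → fold x h P ≡ x → ∀ m → fold x h (m * P) ≡ x
  fold-period-* _ zero = refl
  fold-period-* {x} {P} x-fixed (suc m) = begin
    fold x h (P + m * P)        ≡⟨ fold-+ x h P ⟩
    fold (fold x h (m * P)) h P ≡⟨ cong (λ y → fold y h P) (fold-period-* x-fixed m) ⟩
    fold x h P                  ≡⟨ x-fixed ⟩
    x                           ∎
    where open ≡-Reasoning

  module _ (h-injective : Injective _≡_ _≡_ h) where

    fold-injective : ∀ i → Injective _≡_ _≡_ (λ x → fold x h i)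
    fold-injective zero e = e
    fold-injective (suc i) e = fold-injective i (h-injective e)

    ∃-period : ∀ {N} → A ↣ Fin N → ∀ x → ∃ λ p → fold x h (suc p) ≡ x
    ∃-period {N} A↣Fin x with pigeonhole (n<1+n N) (λ i → to (fold x h (toℕ i)))
      where open Injection A↣Fin
    ... | i , j , i<j , codes≡ with m≤n⇒∃[o]m+o≡n i<j
    ... | o , 1+i+o≡j = o , sym (fold-injective (toℕ i) (begin
      fold x h (toℕ i)                   ≡⟨ Injection.injective A↣Fin codes≡ ⟩
      fold x h (toℕ j)                   ≡⟨ cong (fold x h) (trans (sym 1+i+o≡j) (sym (+-suc (toℕ i) o))) ⟩
      fold x h (toℕ i + suc o)           ≡⟨ fold-+ x h (toℕ i) ⟩
      fold (fold x h (suc o)) h (toℕ i)  ∎))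
      where open ≡-Reasoning

    ∃-common-period : ∀ {N} → A ↣ Fin N → ∀ x y → ∃ λ p → fold x h (suc p) ≡ x × fold y h (suc p) ≡ y
    ∃-common-period A↣Fin x y with ∃-period A↣Fin x | ∃-period A↣Fin y
    ... | p , x-fixed | q , y-fixed =
      q + p * suc q ,
      subst (λ m → fold x h m ≡ x) (*-comm (suc q) (suc p)) (fold-period-* {P = suc p} x-fixed (suc q)) ,
      fold-period-* {P = suc q} y-fixed (suc p)

embedding-into-subrelation⇒⊆ : ∀ {A : Set} {N ℓ} {E F : Rel A ℓ} → A ↣ Fin N → E ⇒ F →
  (h : A → A) → Injective _≡_ _≡_ h → (∀ {x y} → F x y → E (h x) (h y)) → F ⇒ E
embedding-into-subrelation⇒⊆ {E = E} A↣Fin E⇒F h h-injective h-maps-F-to-E {x} {y} Fxy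
  with ∃-common-period h h-injective A↣Fin x y
... | p , x-fixed , y-fixed = subst₂ E x-fixed y-fixed (iterates p)
  where
  iterates : ∀ i → E (fold x h (suc i)) (fold y h (suc i))
  iterates zero = h-maps-F-to-E Fxy
  iterates (suc i) = h-maps-F-to-E (E⇒F (iterates i))

module _ {n} (G : SimpleGraph n) where

  independent⇒clique : ∀ {S} → IsIndependent (complement G) S → IsClique G S
  independent⇒clique independent u v u∈S v∈S u≢v with dec G u v
  ... | yes uv = uv
  ... | no ¬uv = ⊥-elim (independent u v u∈S v∈S (u≢v , ¬uv))

  clique⇒independent : ∀ {S} → IsClique G S → IsIndependent (complement G) S
  clique⇒independent clique u v u∈S v∈S (u≢v , ¬uv) = ¬uv (clique u v u∈S v∈S u≢v)

  toKClique : ∀ {k} → IndSet (complement G) k → KClique G k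
  toKClique (indSet S independent size) = kClique S (independent⇒clique independent) size

  toIndSet : ∀ {k} → KClique G k → IndSet (complement G) k
  toIndSet (kClique S clique size) = indSet S (clique⇒independent clique) size

  KClique-isClique : ∀ {k} (C : KClique G k) → IsClique G (KClique.set C)
  KClique-isClique (kClique _ clique _) u v u∈C v∈C u≢v = recompute (dec G u v) (clique u v u∈C v∈C u≢v)

  KClique-size : ∀ {k} (C : KClique G k) → ∣ KClique.set C ∣ ≡ k
  KClique-size {k} (kClique S _ size) = recompute (∣ S ∣ ≟ k) size

  IndSet-size : ∀ {k} (I : IndSet (complement G) k) → ∣ IndSet.set I ∣ ≡ k
  IndSet-size {k} (indSet S _ size) = recompute (∣ S ∣ ≟ k) size

  IndSet-≡ : ∀ {k} {I J : IndSet (complement G) k} → IndSet.set I ≡ IndSet.set J → I ≡ J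
  IndSet-≡ refl = refl

  IndSet↣Fin : ∀ {k} → IndSet (complement G) k ↣ Fin (2 ^ n)
  IndSet↣Fin = mk↣ (IndSet-≡ ∘ Injection.injective Subset↣Fin[2^n])

  ∪-isClique : ∀ {C D} → IsClique G C → IsClique G D →
    (∀ {x y} → x ∈ C ─ D → y ∈ D ─ C → Adj G x y) → IsClique G (C ∪ D)
  ∪-isClique {C} {D} C-clique D-clique across x y x∈C∪D y∈C∪D x≢y =
    adjacent (x∈p∪q⁻ C D x∈C∪D) (x∈p∪q⁻ C D y∈C∪D)
    where
    mixed : ∀ {x y} → x ∈ C → y ∈ D → x ≢ y → Adj G x y
    mixed {x} {y} x∈C y∈D x≢y with x ∈? D | y ∈? C
    ... | yes x∈D | _ = D-clique x y x∈D y∈D x≢y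
    ... | no _ | yes y∈C = C-clique x y x∈C y∈C x≢y
    ... | no x∉D | no y∉C = across (x∈p∧x∉q⇒x∈p─q x∈C x∉D) (x∈p∧x∉q⇒x∈p─q y∈D y∉C)

    adjacent : x ∈ C ⊎ x ∈ D → y ∈ C ⊎ y ∈ D → Adj G x y
    adjacent (inj₁ x∈C) (inj₁ y∈C) = C-clique x y x∈C y∈C x≢y
    adjacent (inj₂ x∈D) (inj₂ y∈D) = D-clique x y x∈D y∈D x≢y
    adjacent (inj₁ x∈C) (inj₂ y∈D) = mixed x∈C y∈D x≢y
    adjacent (inj₂ x∈D) (inj₁ y∈C) = SimpleGraph.sym G (mixed y∈C x∈D (x≢y ∘ sym))

  TS-edge⇒L-edge : ∀ {k} (I J : IndSet (complement G) k) →
    Graph.E (TS k (complement G)) I J → Graph.E (L k G) (toKClique I) (toKClique J)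
  TS-edge⇒L-edge {k} I J (u , _ , I─J≡⁅u⁆ , _) = begin
    ∣ IndSet.set I ∩ IndSet.set J ∣ ≡⟨ ∣p─q∣≡1⇒∣p∩q∣≡∣p∣∸1 (IndSet.set I) (IndSet.set J) ∣I─J∣≡1 ⟩
    ∣ IndSet.set I ∣ ∸ 1            ≡⟨ cong (_∸ 1) (IndSet-size I) ⟩
    k ∸ 1                           ∎
    where
    open ≡-Reasoning
    ∣I─J∣≡1 : ∣ IndSet.set I ─ IndSet.set J ∣ ≡ 1
    ∣I─J∣≡1 = trans (cong ∣_∣ I─J≡⁅u⁆) (∣⁅x⁆∣≡1 u)

  KFree⇒TS-edge : ∀ {k} → KFree (suc k) G → (C D : KClique G (suc k)) → ∀ {u v} →
    KClique.set C ─ KClique.set D ≡ ⁅ u ⁆ → KClique.set D ─ KClique.set C ≡ ⁅ v ⁆ →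
    Graph.E (TS (suc k) (complement G)) (toIndSet C) (toIndSet D)
  KFree⇒TS-edge {k} K-free C D {u} {v} C─D≡⁅u⁆ D─C≡⁅v⁆ = u , v , C─D≡⁅u⁆ , D─C≡⁅v⁆ , u≢v , ¬uv
    where
    SC = KClique.set C
    SD = KClique.set D

    u≢v : u ≢ v
    u≢v refl = x∈p─q⇒x∉q SD SC
      (subst (u ∈_) (sym D─C≡⁅v⁆) (x∈⁅x⁆ u))
      (p─q⊆p SC SD (subst (u ∈_) (sym C─D≡⁅u⁆) (x∈⁅x⁆ u)))

    ¬uv : ¬ Adj G u v
    ¬uv uv = K-free (SC ∪ SD , ∪-isClique (KClique-isClique C) (KClique-isClique D) across , ∣C∪D∣≡2+k)
      where
      across : ∀ {x y} → x ∈ SC ─ SD → y ∈ SD ─ SC → Adj G x y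
      across x∈C─D y∈D─C = subst₂ (Adj G)
        (sym (x∈⁅y⁆⇒x≡y u (subst (_ ∈_) C─D≡⁅u⁆ x∈C─D)))
        (sym (x∈⁅y⁆⇒x≡y v (subst (_ ∈_) D─C≡⁅v⁆ y∈D─C))) uv

      ∣C∪D∣≡2+k : ∣ SC ∪ SD ∣ ≡ suc (suc k)
      ∣C∪D∣≡2+k = begin
        ∣ SC ∪ SD ∣          ≡⟨ ∣p∪q∣≡∣p∣+∣q─p∣ SC SD ⟩
        ∣ SC ∣ + ∣ SD ─ SC ∣ ≡⟨ cong₂ _+_ (KClique-size C) (trans (cong ∣_∣ D─C≡⁅v⁆) (∣⁅x⁆∣≡1 v)) ⟩
        suc k + 1            ≡⟨ cong suc (+-comm k 1) ⟩
        suc (suc k)          ∎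
        where open ≡-Reasoning

  KFree⇒L-edge⇒TS-edge : ∀ {k} → KFree (suc k) G → (C D : KClique G (suc k)) →
    Graph.E (L (suc k) G) C D → Graph.E (TS (suc k) (complement G)) (toIndSet C) (toIndSet D)
  KFree⇒L-edge⇒TS-edge K-free C D ∣C∩D∣≡k
    with ∣p∣≡1⇒p≡⁅x⁆ (SC ─ SD) (∣p∩q∣≡m⇒∣p─q∣≡1 SC SD (KClique-size C) ∣C∩D∣≡k)
       | ∣p∣≡1⇒p≡⁅x⁆ (SD ─ SC) (∣p∩q∣≡m⇒∣p─q∣≡1 SD SC (KClique-size D) (trans (cong ∣_∣ (∩-comm SD SC)) ∣C∩D∣≡k))
    where
    SC = KClique.set C
    SD = KClique.set D
  ... | _ , C─D≡⁅u⁆ | _ , D─C≡⁅v⁆ = KFree⇒TS-edge K-free C D C─D≡⁅u⁆ D─C≡⁅v⁆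

  ⊆-clique⇒¬TS-edge : ∀ {k S} → IsClique G S → (C D : KClique G k) →
    KClique.set C ⊆ S → KClique.set D ⊆ S → ¬ Graph.E (TS k (complement G)) (toIndSet C) (toIndSet D)
  ⊆-clique⇒¬TS-edge S-clique C D C⊆S D⊆S (u , v , C─D≡⁅u⁆ , D─C≡⁅v⁆ , u≢v , ¬uv) = ¬uv
    (S-clique u v
      (C⊆S (p─q⊆p _ _ (subst (u ∈_) (sym C─D≡⁅u⁆) (x∈⁅x⁆ u))))
      (D⊆S (p─q⊆p _ _ (subst (v ∈_) (sym D─C≡⁅v⁆) (x∈⁅x⁆ v))))
      u≢v)

  clique-minus : ∀ {k S} → IsClique G S → ∣ S ∣ ≡ suc k → ∀ {a} → a ∈ S → KClique G k
  clique-minus {S = S} S-clique ∣S∣≡1+k {a} a∈S = kClique (S - a)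
    (λ u v u∈S-a v∈S-a → S-clique u v (p─q⊆p S ⁅ a ⁆ u∈S-a) (p─q⊆p S ⁅ a ⁆ v∈S-a))
    (x∈p⇒∣p-x∣≡m a∈S ∣S∣≡1+k)

  clique⇒L-edge∖TS-edge : ∀ {k S} → IsClique G S → ∣ S ∣ ≡ suc (suc k) →
    ∃₂ λ C D → Graph.E (L (suc k) G) C D × ¬ Graph.E (TS (suc k) (complement G)) (toIndSet C) (toIndSet D)
  clique⇒L-edge∖TS-edge {k} {S} S-clique ∣S∣≡2+k with ∣p∣≡1+m⇒Nonempty S ∣S∣≡2+k
  ... | a , a∈S with ∣p∣≡1+m⇒Nonempty (S - a) (x∈p⇒∣p-x∣≡m a∈S ∣S∣≡2+k)
  ... | b , b∈S-a =
    C , D ,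
    trans (cong ∣_∣ (p─q∩p─r≡p─q─r S ⁅ a ⁆ ⁅ b ⁆)) (x∈p⇒∣p-x∣≡m b∈S-a (x∈p⇒∣p-x∣≡m a∈S ∣S∣≡2+k)) ,
    ⊆-clique⇒¬TS-edge S-clique C D (p─q⊆p S ⁅ a ⁆) (p─q⊆p S ⁅ b ⁆)
    where
    C D : KClique G (suc k)
    C = clique-minus S-clique ∣S∣≡2+k a∈S
    D = clique-minus S-clique ∣S∣≡2+k (p─q⊆p S ⁅ a ⁆ b∈S-a)

  L≅TS⇒L-edge⇒TS-edge : ∀ {k} → L k G ≅ TS k (complement G) → ∀ C D →
    Graph.E (L k G) C D → Graph.E (TS k (complement G)) (toIndSet C) (toIndSet D)
  L≅TS⇒L-edge⇒TS-edge {k} L≅TS C D =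
    embedding-into-subrelation⇒⊆
      {E = Graph.E (TS k (complement G))}
      {F = λ I J → Graph.E (L k G) (toKClique I) (toKClique J)}
      IndSet↣Fin (λ {I J} → TS-edge⇒L-edge I J) (to ∘ toKClique) h-injective
      (λ {I J} → Equivalence.to (adj (toKClique I) (toKClique J))) {toIndSet C} {toIndSet D}
    where
    open _≅_ L≅TS
    h-injective : Injective _≡_ _≡_ (to ∘ toKClique)
    h-injective {I} {J} e = cong toIndSet (begin
      toKClique I             ≡⟨ from∘to (toKClique I) ⟨
      from (to (toKClique I)) ≡⟨ cong from e ⟩
      from (to (toKClique J)) ≡⟨ from∘to (toKClique J) ⟩
      toKClique J             ∎)
      where open ≡-Reasoning

  L≅TS⇒KFree : ∀ {k} → L (suc k) G ≅ TS (suc k) (complement G) → KFree (suc k) G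
  L≅TS⇒KFree L≅TS (S , S-clique , ∣S∣≡2+k) with clique⇒L-edge∖TS-edge S-clique ∣S∣≡2+k
  ... | C , D , CD∈L , CD∉TS = CD∉TS (L≅TS⇒L-edge⇒TS-edge L≅TS C D CD∈L)

  KFree⇒L≅TS : ∀ {k} → KFree (suc k) G → L (suc k) G ≅ TS (suc k) (complement G)
  KFree⇒L≅TS K-free = record
    { to      = toIndSet
    ; from    = toKClique
    ; from∘to = λ _ → refl
    ; to∘from = λ _ → refl
    ; adj     = λ C D → mk⇔ (KFree⇒L-edge⇒TS-edge K-free C D) (TS-edge⇒L-edge (toIndSet C) (toIndSet D))
    }

lemma1 : ∀ {n} (G : SimpleGraph n) (k : ℕ) → 1 ≤ k →
    (Σ (IndSet (complement G) k → KClique G k) λ f →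
       (∀ I → KClique.set (f I) ≡ IndSet.set I)
       × (Σ (KClique G k → IndSet (complement G) k) λ g →
            (∀ I → g (f I) ≡ I) × (∀ C → f (g C) ≡ C))
       × (∀ I J → Graph.E (TS k (complement G)) I J → Graph.E (L k G) (f I) (f J)))
    × ((L k G ≅ TS k (complement G)) ⇔ KFree k G)
lemma1 G (suc k) (s≤s _) =
  ( toKClique G
  , (λ _ → refl)
  , (toIndSet G , (λ _ → refl) , (λ _ → refl))
  , TS-edge⇒L-edge G )
  , mk⇔ (L≅TS⇒KFree G) (KFree⇒L≅TS G)
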